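{- Let $G$ be a graph and $e$ a permissible edge of $G$, and let $G'$ be obtained from $G$ by subdividing $e$ (replacing $e=\{u,v\}$ by a new vertex $w$ and edges $\{u,w\},\{w,v\}$). Then $G'$ is Hamiltonian if and only if $G$ is Hamiltonian. Moreover, both edges $\{u,w\}$ and $\{w,v\}$ are permissible in $G'$.
   Context: An edge $e$ of a graph $G$ is called permissible if $G$ is not Hamiltonian or $G$ contains a Hamiltonian cycle passing through $e$. -}

module Defs where

open import Data.Nat using (ℕ; zero; suc; _≤_)
open import Data.Fin using (Fin; toℕ) renaming (zero to fzero; suc to fsuc)
open import Data.Product using (_×_; ∃-syntax; _,_)
open import Data.Sum using (_⊎_)
open import Data.Empty using (⊥)
open import Relation.Nullary using (¬_)
open import Relation.Binary.PropositionalEquality using (_≡_)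
open import Function.Definitions using (Injective)

AdjRel : ℕ → Set₁
AdjRel n = Fin n → Fin n → Set

record Graph (n : ℕ) : Set₁ where
  field
    Adj    : AdjRel n
    sym    : ∀ {x y} → Adj x y → Adj y x
    irrefl : ∀ {x} → ¬ Adj x x
open Graph public

SamePair : ∀ {n} → Fin n → Fin n → Fin n → Fin n → Set
SamePair x y u v = (x ≡ u × y ≡ v) ⊎ (x ≡ v × y ≡ u)

CycSucc : ∀ {n} → Fin n → Fin n → Set
CycSucc {n} i j = (suc (toℕ i) ≡ toℕ j) ⊎ (suc (toℕ i) ≡ n × toℕ j ≡ 0)

record HamCycle {n : ℕ} (E : AdjRel n) : Set where
  field
    atLeast3 : 3 ≤ n
    order    : Fin n → Fin n
    inj      : Injective _≡_ _≡_ order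
    adj      : ∀ i j → CycSucc i j → E (order i) (order j)
open HamCycle public

Hamiltonian : ∀ {n} → AdjRel n → Set
Hamiltonian E = HamCycle E

PassesThrough : ∀ {n} {E : AdjRel n} → HamCycle E → Fin n → Fin n → Set
PassesThrough C u v =
  ∃[ i ] ∃[ j ] (CycSucc i j × SamePair (order C i) (order C j) u v)

Permissible : ∀ {n} → AdjRel n → Fin n → Fin n → Set
Permissible E u v = ¬ Hamiltonian E ⊎ (∃[ C ] PassesThrough {E = E} C u v)

-- Subdivision of the edge {u,v}: vertex set Fin (suc n), where fzero is the
-- new vertex w and fsuc i is the old vertex i.
Subdiv : ∀ {n} → Graph n → Fin n → Fin n → AdjRel (suc n)
Subdiv G u v fzero    fzero    = ⊥
Subdiv G u v fzero    (fsuc j) = j ≡ u ⊎ j ≡ v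
Subdiv G u v (fsuc i) fzero    = i ≡ u ⊎ i ≡ v
Subdiv G u v (fsuc i) (fsuc j) = Adj G i j × ¬ SamePair i j u v

-- The new vertex w has degree two, so every Hamiltonian cycle of the subdivision runs
-- u, w, v (or v, w, u) consecutively; deleting w from it gives a Hamiltonian cycle of G
-- through the edge uv, and conversely w can be inserted into any Hamiltonian cycle of G
-- that uses uv. Permissibility of uv says that such a cycle exists as soon as G is
-- Hamiltonian, and then the cycle of the subdivision uses both edges at w.
module Submission where

open import Defs
open import Data.Fin using (Fin; toℕ; fromℕ; fromℕ<; punchOut) renaming (zero to fzero; suc to fsuc)
open import Data.Fin.Properties using (toℕ-injective; toℕ<n; toℕ-fromℕ; toℕ-fromℕ<; fromℕ<-toℕ; 0≢1+n; punchOut-injective; punchIn-punchOut; injective⇒≤; any?; _≟_) renaming (suc-injective to fsuc-injective)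
open import Data.Nat using (ℕ; zero; suc; _≤_; _<_; _<?_; s≤s; s≤s⁻¹)
open import Data.Nat.Properties using (suc-injective; n≮n; 1+n≰n; ≮⇒≥; ≤-antisym; ≤∧≢⇒<; <⇒≢; m≤n⇒m≤1+n; <-trans; n<1+n)
open import Data.Nat.GeneralisedArithmetic using (fold)
open import Data.Product using (_×_; _,_; proj₁; proj₂; ∃-syntax)
open import Data.Sum using (_⊎_; inj₁; inj₂)
open import Function using (_∘_)
open import Function.Bundles using (_⇔_; mk⇔)
open import Function.Definitions using (Injective)
open import Relation.Nullary using (¬_; yes; no; contradiction)
open import Relation.Binary.PropositionalEquality
  using (_≡_; _≢_; refl; cong; subst; subst₂; module ≡-Reasoning)
  renaming (sym to ≡-sym; trans to ≡-trans)

open ≡-Reasoning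

injective⇒surjective : ∀ {n} {f : Fin n → Fin n} → Injective _≡_ _≡_ f → ∀ y → ∃[ x ] f x ≡ y
injective⇒surjective {zero}      _     ()
injective⇒surjective {suc m} {f} f-inj y with any? (λ x → f x ≟ y)
... | yes hit = hit
... | no miss = contradiction (injective⇒≤ f-avoiding-y-injective) 1+n≰n
  where
  y≢f : ∀ x → y ≢ f x
  y≢f x y≡fx = miss (x , ≡-sym y≡fx)

  f-avoiding-y : Fin (suc m) → Fin m
  f-avoiding-y x = punchOut (y≢f x)

  f-avoiding-y-injective : Injective _≡_ _≡_ f-avoiding-y
  f-avoiding-y-injective {x} {x′} = f-inj ∘ punchOut-injective (y≢f x) (y≢f x′)

CycSucc-functional : ∀ {n} {i j k : Fin n} → CycSucc i j → CycSucc i k → j ≡ k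
CycSucc-functional         (inj₁ i→j)      (inj₁ i→k)      = toℕ-injective (≡-trans (≡-sym i→j) i→k)
CycSucc-functional {n} {j = j} (inj₁ i→j) (inj₂ (i-last , _)) =
  contradiction (subst (_< n) (≡-trans (≡-sym i→j) i-last) (toℕ<n j)) (n≮n n)
CycSucc-functional {n} {k = k} (inj₂ (i-last , _)) (inj₁ i→k) =
  contradiction (subst (_< n) (≡-trans (≡-sym i→k) i-last) (toℕ<n k)) (n≮n n)
CycSucc-functional         (inj₂ (_ , j≡0)) (inj₂ (_ , k≡0)) = toℕ-injective (≡-trans j≡0 (≡-sym k≡0))

CycSucc-injective : ∀ {n} {i j k : Fin n} → CycSucc i k → CycSucc j k → i ≡ j
CycSucc-injective (inj₁ i→k)         (inj₁ j→k)         = toℕ-injective (suc-injective (≡-trans i→k (≡-sym j→k)))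
CycSucc-injective (inj₁ i→k)         (inj₂ (_ , k≡0))   = contradiction (≡-trans i→k k≡0) (λ ())
CycSucc-injective (inj₂ (_ , k≡0))   (inj₁ j→k)         = contradiction (≡-trans j→k k≡0) (λ ())
CycSucc-injective (inj₂ (i-last , _)) (inj₂ (j-last , _)) = toℕ-injective (suc-injective (≡-trans i-last (≡-sym j-last)))

toℕ≡⇒≡fromℕ : ∀ {m} {i : Fin (suc m)} → toℕ i ≡ m → i ≡ fromℕ m
toℕ≡⇒≡fromℕ {m} i≡m = toℕ-injective (≡-trans i≡m (≡-sym (toℕ-fromℕ m)))

next : ∀ {m} → Fin (suc m) → Fin (suc m)
next {m} i with suc (toℕ i) <? suc m
... | yes i+1<n = fromℕ< i+1<n
... | no  _     = fzero

CycSucc-next : ∀ {m} (i : Fin (suc m)) → CycSucc i (next i)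
CycSucc-next {m} i with suc (toℕ i) <? suc m
... | yes i+1<n = inj₁ (≡-sym (toℕ-fromℕ< i+1<n))
... | no  i+1≮n = inj₂ (≤-antisym (toℕ<n i) (≮⇒≥ i+1≮n) , refl)

next-injective : ∀ {m} → Injective _≡_ _≡_ (next {m})
next-injective {x = i} {j} eq = CycSucc-injective (CycSucc-next i) (subst (CycSucc j) (≡-sym eq) (CycSucc-next j))

CycSucc⇒next : ∀ {m} {i j : Fin (suc m)} → CycSucc i j → next i ≡ j
CycSucc⇒next {i = i} = CycSucc-functional (CycSucc-next i)

shift : ∀ {m} → ℕ → Fin (suc m) → Fin (suc m)
shift p i = fold i next p

shift-injective : ∀ {m} p → Injective _≡_ _≡_ (shift {m} p)
shift-injective zero    eq = eq
shift-injective (suc p) eq = shift-injective p (next-injective eq)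

shift-next : ∀ {m} p (i : Fin (suc m)) → shift p (next i) ≡ next (shift p i)
shift-next zero    i = refl
shift-next (suc p) i = cong next (shift-next p i)

shift-fzero : ∀ {m} p (p<n : p < suc m) → shift p fzero ≡ fromℕ< p<n
shift-fzero zero    _     = refl
shift-fzero (suc p) p+1<n = begin
  next (shift p fzero)  ≡⟨ cong next (shift-fzero p p<n) ⟩
  next (fromℕ< p<n)     ≡⟨ CycSucc⇒next (inj₁ (≡-trans (cong suc (toℕ-fromℕ< p<n)) (≡-sym (toℕ-fromℕ< p+1<n)))) ⟩
  fromℕ< p+1<n          ∎
  where p<n = <-trans (n<1+n p) p+1<n

shift-to : ∀ {m} (i : Fin (suc m)) → shift (toℕ i) fzero ≡ i
shift-to i = ≡-trans (shift-fzero (toℕ i) (toℕ<n i)) (fromℕ<-toℕ i (toℕ<n i))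

rotate : ∀ {m} {E : AdjRel (suc m)} → HamCycle E → ℕ → HamCycle E
rotate {E = E} C p = record
  { atLeast3 = atLeast3 C
  ; order    = order C ∘ shift p
  ; inj      = shift-injective p ∘ inj C
  ; adj      = shifted-adj
  }
  where
  shifted-step : ∀ {i j} → CycSucc i j → next (shift p i) ≡ shift p j
  shifted-step {i} i→j = ≡-trans (≡-sym (shift-next p i)) (cong (shift p) (CycSucc⇒next i→j))

  shifted-adj : ∀ i j → CycSucc i j → E (order C (shift p i)) (order C (shift p j))
  shifted-adj i j i→j = subst (E (order C (shift p i)) ∘ order C) (shifted-step i→j) (adj C _ _ (CycSucc-next (shift p i)))

rotate-fzero : ∀ {m} {E : AdjRel (suc m)} (C : HamCycle E) (i : Fin (suc m)) →
  order (rotate C (toℕ i)) fzero ≡ order C i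
rotate-fzero C i = cong (order C) (shift-to i)

rotate-last : ∀ {m} {E : AdjRel (suc m)} (C : HamCycle E) {i j : Fin (suc m)} → CycSucc i j →
  order (rotate C (toℕ j)) (fromℕ m) ≡ order C i
rotate-last {m} C {i} {j} i→j = cong (order C) (next-injective (begin
  next (shift (toℕ j) (fromℕ m))  ≡⟨ ≡-sym (shift-next (toℕ j) (fromℕ m)) ⟩
  shift (toℕ j) (next (fromℕ m))  ≡⟨ cong (shift (toℕ j)) (CycSucc⇒next (inj₂ (cong suc (toℕ-fromℕ m) , refl))) ⟩
  shift (toℕ j) fzero             ≡⟨ shift-to j ⟩
  j                               ≡⟨ ≡-sym (CycSucc⇒next i→j) ⟩
  next i                          ∎))

module _ {n : ℕ} where

  SamePair-sym : {x y a b : Fin n} → SamePair x y a b → SamePair a b x y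
  SamePair-sym (inj₁ (refl , refl)) = inj₁ (refl , refl)
  SamePair-sym (inj₂ (refl , refl)) = inj₂ (refl , refl)

  SamePair-trans : {x y a b u v : Fin n} → SamePair x y a b → SamePair a b u v → SamePair x y u v
  SamePair-trans (inj₁ (refl , refl)) ab~uv                = ab~uv
  SamePair-trans (inj₂ (refl , refl)) (inj₁ (refl , refl)) = inj₂ (refl , refl)
  SamePair-trans (inj₂ (refl , refl)) (inj₂ (refl , refl)) = inj₁ (refl , refl)

  SamePair-swap : {x y u v : Fin n} → SamePair x y u v → SamePair y x u v
  SamePair-swap = SamePair-trans (inj₂ (refl , refl))

  SamePair-flip : {x y u v : Fin n} → SamePair x y u v → SamePair x y v u
  SamePair-flip xy~uv = SamePair-trans xy~uv (inj₂ (refl , refl))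

  SamePair-fst : {x y u v : Fin n} → SamePair x y u v → x ≡ u ⊎ x ≡ v
  SamePair-fst (inj₁ (x≡u , _)) = inj₁ x≡u
  SamePair-fst (inj₂ (x≡v , _)) = inj₂ x≡v

  SamePair-snd : {x y u v : Fin n} → SamePair x y u v → y ≡ u ⊎ y ≡ v
  SamePair-snd = SamePair-fst ∘ SamePair-swap

  SamePair-cover : {x y u v z : Fin n} → SamePair x y u v → z ≡ u ⊎ z ≡ v → z ≡ x ⊎ z ≡ y
  SamePair-cover (inj₁ (refl , refl)) z∈uv        = z∈uv
  SamePair-cover (inj₂ (refl , refl)) (inj₁ refl) = inj₂ refl
  SamePair-cover (inj₂ (refl , refl)) (inj₂ refl) = inj₁ refl

  SamePair-intro : {x y u v : Fin n} → x ≡ u ⊎ x ≡ v → y ≡ u ⊎ y ≡ v → x ≢ y → SamePair x y u v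
  SamePair-intro (inj₁ refl) (inj₁ refl) x≢y = contradiction refl x≢y
  SamePair-intro (inj₁ refl) (inj₂ refl) _   = inj₁ (refl , refl)
  SamePair-intro (inj₂ refl) (inj₁ refl) _   = inj₂ (refl , refl)
  SamePair-intro (inj₂ refl) (inj₂ refl) x≢y = contradiction refl x≢y

  Adj-SamePair : (G : Graph n) {x y u v : Fin n} → Adj G u v → SamePair x y u v → Adj G x y
  Adj-SamePair G uv (inj₁ (refl , refl)) = uv
  Adj-SamePair G uv (inj₂ (refl , refl)) = Graph.sym G uv

PassesThrough-sym : ∀ {n} {E : AdjRel n} {C : HamCycle E} {a b : Fin n} →
  PassesThrough C a b → PassesThrough C b a
PassesThrough-sym (i , j , i→j , ij~ab) = i , j , i→j , SamePair-flip ij~ab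

Permissible-sym : ∀ {n} {E : AdjRel n} {a b : Fin n} → Permissible E a b → Permissible E b a
Permissible-sym (inj₁ ¬H)             = inj₁ ¬H
Permissible-sym (inj₂ (C , through)) = inj₂ (C , PassesThrough-sym {C = C} through)

module _ {m : ℕ} (G : Graph (suc m)) (u v : Fin (suc m)) where

  module FromSubdivision (C : HamCycle (Subdiv G u v)) (w-first : order C fzero ≡ fzero) where

    w-not-later : ∀ k → fzero ≢ order C (fsuc k)
    w-not-later k w≡ = 0≢1+n (inj C (≡-trans w-first w≡))

    remove-w : Fin (suc m) → Fin (suc m)
    remove-w k = punchOut (w-not-later k)

    remove-w-spec : ∀ k → order C (fsuc k) ≡ fsuc (remove-w k)
    remove-w-spec k = ≡-sym (punchIn-punchOut (w-not-later k))

    remove-w-injective : Injective _≡_ _≡_ remove-w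
    remove-w-injective {k} {l} eq =
      fsuc-injective (inj C (punchOut-injective (w-not-later k) (w-not-later l) eq))

    inner-edge : ∀ k l → suc (toℕ k) ≡ toℕ l →
      Adj G (remove-w k) (remove-w l) × ¬ SamePair (remove-w k) (remove-w l) u v
    inner-edge k l k→l = subst₂ (Subdiv G u v) (remove-w-spec k) (remove-w-spec l)
      (adj C (fsuc k) (fsuc l) (inj₁ (cong suc k→l)))

    first-at-w : remove-w fzero ≡ u ⊎ remove-w fzero ≡ v
    first-at-w = subst₂ (Subdiv G u v) w-first (remove-w-spec fzero) (adj C fzero (fsuc fzero) (inj₁ refl))

    last-at-w : remove-w (fromℕ m) ≡ u ⊎ remove-w (fromℕ m) ≡ v
    last-at-w = subst₂ (Subdiv G u v) (remove-w-spec (fromℕ m)) w-first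
      (adj C (fsuc (fromℕ m)) fzero (inj₂ (cong (suc ∘ suc) (toℕ-fromℕ m) , refl)))

    1≤m : 1 ≤ m
    1≤m = s≤s⁻¹ (s≤s⁻¹ (atLeast3 C))

    ends : SamePair (remove-w (fromℕ m)) (remove-w fzero) u v
    ends = SamePair-intro last-at-w first-at-w
      (λ eq → <⇒≢ 1≤m (≡-sym (≡-trans (≡-sym (toℕ-fromℕ m)) (cong toℕ (remove-w-injective eq)))))

    -- A Hamiltonian cycle w, u, v of the subdivision would use the deleted edge uv.
    m≢1 : m ≢ 1
    m≢1 m≡1 = proj₂ (inner-edge fzero (fromℕ m) (≡-sym (≡-trans (toℕ-fromℕ m) m≡1))) (SamePair-swap ends)

    cycle : Adj G u v → HamCycle (Adj G)
    cycle uv = record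
      { atLeast3 = s≤s (≤∧≢⇒< 1≤m (m≢1 ∘ ≡-sym))
      ; order    = remove-w
      ; inj      = remove-w-injective
      ; adj      = remove-w-adj
      }
      where
      remove-w-adj : ∀ i j → CycSucc i j → Adj G (remove-w i) (remove-w j)
      remove-w-adj i j      (inj₁ i→j)          = proj₁ (inner-edge i j i→j)
      remove-w-adj i fzero  (inj₂ (i-last , _)) =
        subst (λ k → Adj G (remove-w k) (remove-w fzero)) (≡-sym (toℕ≡⇒≡fromℕ (suc-injective i-last))) (Adj-SamePair G uv ends)
      remove-w-adj i (fsuc j) (inj₂ (_ , ()))

    passes-w : ∀ {x} → x ≡ u ⊎ x ≡ v → PassesThrough C (fsuc x) fzero
    passes-w x∈uv with SamePair-cover ends x∈uv
    ... | inj₁ refl = fsuc (fromℕ m) , fzero , inj₂ (cong (suc ∘ suc) (toℕ-fromℕ m) , refl)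
                    , inj₁ (remove-w-spec (fromℕ m) , w-first)
    ... | inj₂ refl = fzero , fsuc fzero , inj₁ refl , inj₂ (w-first , remove-w-spec fzero)

  module ToSubdivision (C : HamCycle (Adj G)) (ends : SamePair (order C (fromℕ m)) (order C fzero) u v) where

    2≤m : 2 ≤ m
    2≤m = s≤s⁻¹ (atLeast3 C)

    insert-w : Fin (suc (suc m)) → Fin (suc (suc m))
    insert-w fzero    = fzero
    insert-w (fsuc k) = fsuc (order C k)

    insert-w-injective : Injective _≡_ _≡_ insert-w
    insert-w-injective {fzero}  {fzero}  _  = refl
    insert-w-injective {fsuc k} {fsuc l} eq = cong fsuc (inj C (fsuc-injective eq))

    inner-edge-kept : ∀ {k l} → suc (toℕ k) ≡ toℕ l → ¬ SamePair (order C k) (order C l) u v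
    inner-edge-kept {k} {l} k→l kl~uv with SamePair-trans kl~uv (SamePair-sym ends)
    ... | inj₁ (k~last , _) = n≮n (suc m) (subst (_< suc m) l≡m+1 (toℕ<n l))
      where
      l≡m+1 : toℕ l ≡ suc m
      l≡m+1 = begin
        toℕ l                ≡⟨ ≡-sym k→l ⟩
        suc (toℕ k)          ≡⟨ cong (suc ∘ toℕ) (inj C k~last) ⟩
        suc (toℕ (fromℕ m))  ≡⟨ cong suc (toℕ-fromℕ m) ⟩
        suc m                ∎
    ... | inj₂ (k~first , l~last) = <⇒≢ 2≤m 1≡m
      where
      1≡m : 1 ≡ m
      1≡m = begin
        1              ≡⟨ cong (suc ∘ toℕ) (≡-sym (inj C k~first)) ⟩
        suc (toℕ k)    ≡⟨ k→l ⟩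
        toℕ l          ≡⟨ cong toℕ (inj C l~last) ⟩
        toℕ (fromℕ m)  ≡⟨ toℕ-fromℕ m ⟩
        m              ∎

    insert-w-adj : ∀ i j → CycSucc i j → Subdiv G u v (insert-w i) (insert-w j)
    insert-w-adj fzero    fzero            (inj₁ ())
    insert-w-adj fzero    fzero            (inj₂ (() , _))
    insert-w-adj fzero    (fsuc fzero)     _                   = SamePair-snd ends
    insert-w-adj fzero    (fsuc (fsuc _))  (inj₁ ())
    insert-w-adj fzero    (fsuc (fsuc _))  (inj₂ (() , _))
    insert-w-adj (fsuc k) fzero            (inj₁ ())
    insert-w-adj (fsuc k) fzero            (inj₂ (k-last , _)) =
      subst (λ l → order C l ≡ u ⊎ order C l ≡ v) (≡-sym (toℕ≡⇒≡fromℕ (suc-injective (suc-injective k-last)))) (SamePair-fst ends)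
    insert-w-adj (fsuc k) (fsuc l)         (inj₁ k→l)          =
      adj C k l (inj₁ (suc-injective k→l)) , inner-edge-kept (suc-injective k→l)
    insert-w-adj (fsuc k) (fsuc l)         (inj₂ (_ , ()))

    cycle : HamCycle (Subdiv G u v)
    cycle = record
      { atLeast3 = m≤n⇒m≤1+n (atLeast3 C)
      ; order    = insert-w
      ; inj      = insert-w-injective
      ; adj      = insert-w-adj
      }

  subdivide : (C : HamCycle (Adj G)) → PassesThrough C u v → HamCycle (Subdiv G u v)
  subdivide C (i , j , i→j , ij~uv) = ToSubdivision.cycle (rotate C (toℕ j)) ends
    where
    ends : SamePair (order (rotate C (toℕ j)) (fromℕ m)) (order (rotate C (toℕ j)) fzero) u v
    ends = subst₂ (λ a b → SamePair a b u v) (≡-sym (rotate-last C i→j)) (≡-sym (rotate-fzero C j)) ij~uv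

  starting-at-w : HamCycle (Subdiv G u v) → ∃[ C ] order C fzero ≡ fzero
  starting-at-w C with injective⇒surjective (inj C) fzero
  ... | p , p↦w = rotate C (toℕ p) , ≡-trans (rotate-fzero C p) p↦w

  unsubdivide : Adj G u v → HamCycle (Subdiv G u v) → HamCycle (Adj G)
  unsubdivide uv C with starting-at-w C
  ... | C′ , w-first = FromSubdivision.cycle C′ w-first uv

  passes-through-w : ∀ {x} → x ≡ u ⊎ x ≡ v → HamCycle (Subdiv G u v) → ∃[ C ] PassesThrough C (fsuc x) fzero
  passes-through-w x∈uv C with starting-at-w C
  ... | C′ , w-first = C′ , FromSubdivision.passes-w C′ w-first x∈uv

lemma18 : ∀ {n : ℕ} (G : Graph n) (u v : Fin n) → Adj G u v →
    Permissible (Adj G) u v →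
    (Hamiltonian (Subdiv G u v) ⇔ Hamiltonian (Adj G))
    × Permissible (Subdiv G u v) (fsuc u) fzero
    × Permissible (Subdiv G u v) fzero (fsuc v)
lemma18 {zero}  G () v
lemma18 {suc m} G u v uv (inj₁ ¬H) =
  mk⇔ (unsubdivide G u v uv) (λ H → contradiction H ¬H) , inj₁ ¬H′ , inj₁ ¬H′
  where
  ¬H′ : ¬ Hamiltonian (Subdiv G u v)
  ¬H′ = ¬H ∘ unsubdivide G u v uv
lemma18 {suc m} G u v uv (inj₂ (C , through)) =
  mk⇔ (unsubdivide G u v uv) (λ _ → C′) ,
  inj₂ (passes-through-w G u v (inj₁ refl) C′) , Permissible-sym (inj₂ (passes-through-w G u v (inj₂ refl) C′))
  where
  C′ : HamCycle (Subdiv G u v)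
  C′ = subdivide G u v C through
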